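{- Let $k$ be a positive integer and $N_k$ a number such that for every prime $p_m \geq N_k$ one has $\sqrt{p_m} - \sqrt{p_{m-1}} < \frac{1}{k}$. Then for every prime $p_n$ with $\frac{p_n}{2} > N_k$, the open interval $\left(\frac{p_n}{2}, p_n\right)$ contains at least $\left[\frac{k}{4}\sqrt{p_n}\right]$ prime numbers.
   Context: $p_m$ denotes the $m$-th prime number ($p_1 = 2$), so $p_{m-1}$ is the prime immediately preceding $p_m$. $[x]$ denotes the integer part (floor) of $x$.
   Formalization: The threshold $N_k$ ranges over the rationals. -}

module Defs where

open import Data.Nat using (ℕ; suc; _+_; _*_; _∸_; _≤_; _<_; _<?_)
open import Data.Nat.Primality using (Prime; prime?)
open import Data.List using (List; length; filter; upTo)
open import Data.Sum using (_⊎_)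
open import Data.Product using (_×_)
open import Relation.Nullary using (¬_)
open import Relation.Nullary.Decidable using (_×-dec_)

ConsecutivePrimes : ℕ → ℕ → Set
ConsecutivePrimes q p = Prime q × Prime p × q < p × (∀ r → q < r → r < p → ¬ Prime r)

-- SqrtGapLt k a b  expresses  √a − √b < 1/k  (k ≥ 1), without reals.
-- With X = k²a, Y = k²b it is  √X < √Y + 1, i.e. X ≤ Y, or X ≥ Y+1 and (X−Y−1)² < 4Y.
SqrtGapLt : ℕ → ℕ → ℕ → Set
SqrtGapLt k a b =
  (k * k * a ≤ k * k * b) ⊎
  ((suc (k * k * b) ≤ k * k * a) ×
   ((k * k * a ∸ suc (k * k * b)) * (k * k * a ∸ suc (k * k * b)) < 4 * (k * k * b)))

primesInHalfInterval : ℕ → ℕ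
primesInHalfInterval p = length (filter (λ q → prime? q ×-dec (p <? 2 * q)) (upTo p))

-- "c ≥ [ (k/4) √p ]" : c bounds every natural t with t ≤ (k/4)√p, i.e. 16 t² ≤ k² p
AtLeastFloorKQuarterSqrt : ℕ → ℕ → ℕ → Set
AtLeastFloorKQuarterSqrt c k p = ∀ t → 16 * (t * t) ≤ k * k * p → t ≤ c

-- Walk down from p through consecutive primes p = q₀ > q₁ > ⋯ > q_{c+1}, where q₁, …, q_c are the c primes
-- in (p/2, p) and q_{c+1} ≤ p/2. Every step starts above p/2 > N, so k√qᵢ − k√qᵢ₊₁ < 1, and summing gives
-- (1 − 1/√2) k√p < k√p − k√q_{c+1} < c + 1; as 1 − 1/√2 > 1/4 this forces c ≥ t whenever 4t ≤ k√p.
-- Without reals, k√x is tracked by integers u with u² ≤ 25k²x, i.e. a rounded-down 5k√x, the factor 5 leaving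
-- room for the rounding; the walk is run as an upward scan over x = 3, …, p + 1 remembering the last prime below x.
module Submission where

open import Defs
open import Data.Nat using (ℕ; _≤_; NonZero)
open import Data.Nat.Primality using (Prime)
open import Data.Integer using (+_)
open import Data.Rational using (ℚ; _/_)
import Data.Rational as Q

open import Data.Nat using (zero; suc; _+_; _*_; _∸_; _<_; z≤n; s≤s; _≤?_; _<?_)
open import Data.Nat.Properties
open import Data.Nat.Primality using (prime?; prime[2]; prime⇒nonZero; composite[4]; composite⇒¬prime)
open import Data.Nat.Tactic.RingSolver using (solve)
import Data.Integer as ℤ
import Data.Integer.Properties as ℤ
import Data.Rational.Properties as Q
import Data.Rational.Unnormalised as ℚᵘ
import Data.Rational.Unnormalised.Properties as ℚᵘ
open import Data.List using ([]; _∷_; [_]; _++_; length; filter; upTo)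
open import Function using (_∘_)
import Data.List.Properties as List
open import Data.Sum using (_⊎_; inj₁; inj₂)
open import Data.Product using (_×_; _,_; proj₁; ∃-syntax)
open import Relation.Nullary using (¬_; yes; no; contradiction)
open import Relation.Nullary.Decidable using (_×-dec_; from-yes)
open import Relation.Unary using (Pred; Decidable)
open import Relation.Binary.PropositionalEquality using (_≡_; refl; sym; trans; cong; subst; subst₂; module ≡-Reasoning)

-- √X < √Y + 1 with both sides squared; SqrtGapLt k a b unfolds to Sqrt<Sqrt+1 (k * k * a) (k * k * b).
Sqrt<Sqrt+1 : ℕ → ℕ → Set
Sqrt<Sqrt+1 X Y = X ≤ Y ⊎ (suc Y ≤ X × (X ∸ suc Y) * (X ∸ suc Y) < 4 * Y)

square-mono-≤ : ∀ {m n} → m ≤ n → m * m ≤ n * n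
square-mono-≤ m≤n = *-mono-≤ m≤n m≤n

square-cancel-< : ∀ {m n} → m * m < n * n → m < n
square-cancel-< m²<n² = ≰⇒> (λ n≤m → <⇒≱ m²<n² (square-mono-≤ n≤m))

sqrt-descent-+ : ∀ a {X Y} v → Sqrt<Sqrt+1 X Y → (a + v) * (a + v) ≤ a * a * X → v * v ≤ a * a * Y
sqrt-descent-+ a {X} {Y} v (inj₁ X≤Y) h = begin
  v * v             ≤⟨ square-mono-≤ (m≤n+m v a) ⟩
  (a + v) * (a + v) ≤⟨ h ⟩
  a * a * X         ≤⟨ *-monoʳ-≤ (a * a) X≤Y ⟩
  a * a * Y         ∎
  where open ≤-Reasoning
sqrt-descent-+ a {X} {Y} v (inj₂ (Y<X , d²<4Y)) h =
  descent (X ∸ suc Y) d²<4Y (subst (λ X → (a + v) * (a + v) ≤ a * a * X) (sym (m∸n+n≡m Y<X)) h)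
  where
  descent : ∀ d → d * d < 4 * Y → (a + v) * (a + v) ≤ a * a * (d + suc Y) → v * v ≤ a * a * Y
  descent d d²<4Y h with v * v ≤? a * a * Y
  ... | yes v²≤a²Y = v²≤a²Y
  ... | no v²≰a²Y = contradiction h (<⇒≱ a²X<[a+v]²)
    where
    open ≤-Reasoning
    a²Y<v² : a * a * Y < v * v
    a²Y<v² = ≰⇒> v²≰a²Y
    ad<2v : a * d < 2 * v
    ad<2v = square-cancel-< (begin-strict
      a * d * (a * d) ≡⟨ solve (a ∷ d ∷ []) ⟩
      a * a * (d * d) ≤⟨ *-monoʳ-≤ (a * a) (<⇒≤ d²<4Y) ⟩
      a * a * (4 * Y) ≡⟨ solve (a ∷ Y ∷ []) ⟩
      4 * (a * a * Y) <⟨ *-monoʳ-< 4 a²Y<v² ⟩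
      4 * (v * v)     ≡⟨ solve (v ∷ []) ⟩
      2 * v * (2 * v) ∎)
    a²X<[a+v]² : a * a * (d + suc Y) < (a + v) * (a + v)
    a²X<[a+v]² = begin-strict
      a * a * (d + suc Y)             ≡⟨ solve (a ∷ d ∷ Y ∷ []) ⟩
      a * (a * d) + a * a + a * a * Y <⟨ +-mono-≤-< (+-monoˡ-≤ (a * a) (*-monoʳ-≤ a (<⇒≤ ad<2v))) a²Y<v² ⟩
      a * (2 * v) + a * a + v * v     ≡⟨ solve (a ∷ v ∷ []) ⟩
      (a + v) * (a + v)               ∎

sqrt-descent : ∀ a {X Y} u → Sqrt<Sqrt+1 X Y → u * u ≤ a * a * X → (u ∸ a) * (u ∸ a) ≤ a * a * Y
sqrt-descent a u gap u²≤a²X with ≤-total u a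
... | inj₁ u≤a rewrite m≤n⇒m∸n≡0 u≤a = z≤n
... | inj₂ a≤u = sqrt-descent-+ a (u ∸ a) gap (subst (λ w → w * w ≤ _) (sym (m+[n∸m]≡n a≤u)) u²≤a²X)

floor-sqrt : ∀ n → ∃[ s ] s * s ≤ n × n < suc s * suc s
floor-sqrt zero = 0 , z≤n , s≤s z≤n
floor-sqrt (suc n) with floor-sqrt n
... | s , s²≤n , n<[1+s]² with suc s * suc s ≤? suc n
...   | yes [1+s]²≤1+n = suc s , [1+s]²≤1+n , <-≤-trans (s≤s n<[1+s]²) (*-mono-< (n<1+n (suc s)) (n<1+n (suc s)))
...   | no [1+s]²≰1+n = s , ≤-trans s²≤n (n≤1+n n) , ≰⇒> [1+s]²≰1+n

16*[1+s]²≤18*s² : ∀ {s} → 20 ≤ s → 16 * (suc s * suc s) ≤ 18 * (s * s)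
16*[1+s]²≤18*s² {s} 20≤s = subst (λ s → 16 * (suc s * suc s) ≤ 18 * (s * s)) (m+[n∸m]≡n 20≤s) (offset (s ∸ 20))
  where
  offset : ∀ r → 16 * (suc (20 + r) * suc (20 + r)) ≤ 18 * ((20 + r) * (20 + r))
  offset r = begin
    16 * (suc (20 + r) * suc (20 + r))                                 ≤⟨ m≤m+n _ _ ⟩
    16 * (suc (20 + r) * suc (20 + r)) + (144 + 48 * r + 2 * (r * r)) ≡⟨ solve (r ∷ []) ⟩
    18 * ((20 + r) * (20 + r))                                         ∎
    where open ≤-Reasoning

3*s≤4*[s∸5t] : ∀ {s} t → 20 * t ≤ s → 3 * s ≤ 4 * (s ∸ 5 * t)
3*s≤4*[s∸5t] {s} t 20t≤s = begin
  3 * s                 ≡⟨ sym (m+n∸n≡m (3 * s) s) ⟩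
  3 * s + s ∸ s         ≡⟨ cong (_∸ s) (solve (s ∷ [])) ⟩
  4 * s ∸ s             ≤⟨ ∸-monoʳ-≤ (4 * s) 20t≤s ⟩
  4 * s ∸ 20 * t        ≡⟨ cong (4 * s ∸_) (*-assoc 4 5 t) ⟩
  4 * s ∸ 4 * (5 * t)   ≡⟨ sym (*-distribˡ-∸ 4 s (5 * t)) ⟩
  4 * (s ∸ 5 * t)       ∎
  where open ≤-Reasoning

[1+s]²≤2*w² : ∀ {s w} → 20 ≤ s → 3 * s ≤ 4 * w → suc s * suc s ≤ 2 * (w * w)
[1+s]²≤2*w² {s} {w} 20≤s 3s≤4w = *-cancelˡ-≤ 16 (begin
  16 * (suc s * suc s)  ≤⟨ 16*[1+s]²≤18*s² 20≤s ⟩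
  18 * (s * s)          ≡⟨ solve (s ∷ []) ⟩
  2 * (3 * s * (3 * s)) ≤⟨ *-monoʳ-≤ 2 (square-mono-≤ 3s≤4w) ⟩
  2 * (4 * w * (4 * w)) ≡⟨ solve (w ∷ []) ⟩
  16 * (2 * (w * w))    ∎)
  where open ≤-Reasoning

module _ {ℓ} {P : Pred ℕ ℓ} (P? : Decidable P) where

  countBelow : ℕ → ℕ
  countBelow n = length (filter P? (upTo n))

  private
    countBelow-suc : ∀ n → countBelow (suc n) ≡ countBelow n + length (filter P? [ n ])
    countBelow-suc n = begin
      length (filter P? (upTo (suc n)))                ≡⟨ cong (length ∘ filter P?) (sym (List.upTo-∷ʳ n)) ⟩
      length (filter P? (upTo n ++ [ n ]))             ≡⟨ cong length (List.filter-++ P? (upTo n) [ n ]) ⟩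
      length (filter P? (upTo n) ++ filter P? [ n ])   ≡⟨ List.length-++ (filter P? (upTo n)) ⟩
      countBelow n + length (filter P? [ n ])          ∎
      where open ≡-Reasoning

  countBelow-accept : ∀ {n} → P n → countBelow (suc n) ≡ suc (countBelow n)
  countBelow-accept {n} Pn = begin
    countBelow (suc n)                      ≡⟨ countBelow-suc n ⟩
    countBelow n + length (filter P? [ n ]) ≡⟨ cong (λ xs → countBelow n + length xs) (List.filter-accept P? Pn) ⟩
    countBelow n + 1                        ≡⟨ +-comm (countBelow n) 1 ⟩
    suc (countBelow n)                      ∎
    where open ≡-Reasoning

  countBelow-reject : ∀ {n} → ¬ P n → countBelow (suc n) ≡ countBelow n
  countBelow-reject {n} ¬Pn = begin
    countBelow (suc n)                      ≡⟨ countBelow-suc n ⟩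
    countBelow n + length (filter P? [ n ]) ≡⟨ cong (λ xs → countBelow n + length xs) (List.filter-reject P? ¬Pn) ⟩
    countBelow n + 0                        ≡⟨ +-identityʳ (countBelow n) ⟩
    countBelow n                            ∎
    where open ≡-Reasoning

PrecedingPrime : ℕ → ℕ → Set
PrecedingPrime g x = Prime g × g < x × (∀ r → g < r → r < x → ¬ Prime r)

precedingPrime[3] : PrecedingPrime 2 3
precedingPrime[3] = prime[2] , n<1+n 2 , λ r 2<r r<3 → contradiction r<3 (≤⇒≯ 2<r)

precedingPrime-self : ∀ {x} → Prime x → PrecedingPrime x (suc x)
precedingPrime-self {x} px = px , n<1+n x , λ r x<r r<1+x → contradiction r<1+x (≤⇒≯ x<r)

precedingPrime-skip : ∀ {g x} → ¬ Prime x → PrecedingPrime g x → PrecedingPrime g (suc x)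
precedingPrime-skip {g} {x} ¬px (pg , g<x , gap) = pg , m<n⇒m<1+n g<x , gap′
  where
  gap′ : ∀ r → g < r → r < suc x → ¬ Prime r
  gap′ r g<r r<1+x with m<1+n⇒m<n∨m≡n r<1+x
  ... | inj₁ r<x  = gap r g<r r<x
  ... | inj₂ refl = ¬px

precedingPrime-unique : ∀ {g x} → Prime x → PrecedingPrime g (suc x) → g ≡ x
precedingPrime-unique {g} {x} px (_ , g<1+x , gap) with m<1+n⇒m<n∨m≡n g<1+x
... | inj₁ g<x = contradiction px (gap x g<x (n<1+n x))
... | inj₂ g≡x = g≡x

consecutivePrimes[3,5] : ConsecutivePrimes 3 5
consecutivePrimes[3,5] = from-yes (prime? 3) , from-yes (prime? 5) , s≤s (s≤s (s≤s (s≤s z≤n))) , gap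
  where
  gap : ∀ r → 3 < r → r < 5 → ¬ Prime r
  gap r 3<r r<5 rewrite ≤-antisym (<⇒≤pred r<5) 3<r = composite⇒¬prime composite[4]

fraction-< : ∀ m n a b → m * suc b < n * suc a → + m / suc a Q.< + n / suc b
fraction-< m n a b mb<na = Q.toℚᵘ-cancel-<
  (ℚᵘ.<-respˡ-≃ (ℚᵘ.≃-sym (Q.toℚᵘ-fromℚᵘ (ℚᵘ.mkℚᵘ (+ m) a)))
    (ℚᵘ.<-respʳ-≃ (ℚᵘ.≃-sym (Q.toℚᵘ-fromℚᵘ (ℚᵘ.mkℚᵘ (+ n) b)))
      (ℚᵘ.*<* (subst₂ ℤ._<_ (ℤ.pos-* m (suc b)) (ℤ.pos-* n (suc a)) (ℤ.+<+ mb<na)))))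

<half⇒≤ : ∀ {N p} x → N Q.< + p / 2 → p < 2 * x → N Q.≤ + x / 1
<half⇒≤ {N} {p} x N<p/2 p<2x = Q.<⇒≤ (Q.<-trans N<p/2 (fraction-< p x 1 0 p<x*2))
  where
  p<x*2 : p * 1 < x * 2
  p<x*2 = subst₂ _<_ (sym (*-identityʳ p)) (*-comm 2 x) p<2x

¬Sqrt<Sqrt+1[5K,3K] : ∀ j → ¬ Sqrt<Sqrt+1 ((4 + j) * 5) ((4 + j) * 3)
¬Sqrt<Sqrt+1[5K,3K] j (inj₁ 5K≤3K) with *-cancelˡ-≤ {5} {3} (4 + j) 5K≤3K
... | s≤s (s≤s (s≤s ()))
¬Sqrt<Sqrt+1[5K,3K] j (inj₂ (_ , d²<12K)) =
  <⇒≱ (subst (λ d → d * d < 4 * ((4 + j) * 3)) d≡7+2j d²<12K) 12K≤[7+2j]²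
  where
  3K+1 = suc ((4 + j) * 3)
  5K≡7+2j+3K+1 : (4 + j) * 5 ≡ 7 + 2 * j + suc ((4 + j) * 3)
  5K≡7+2j+3K+1 = solve (j ∷ [])
  d≡7+2j : (4 + j) * 5 ∸ 3K+1 ≡ 7 + 2 * j
  d≡7+2j = trans (cong (_∸ 3K+1) 5K≡7+2j+3K+1) (m+n∸n≡m (7 + 2 * j) 3K+1)
  12K≤[7+2j]² : 4 * ((4 + j) * 3) ≤ (7 + 2 * j) * (7 + 2 * j)
  12K≤[7+2j]² = begin
    4 * ((4 + j) * 3)                                ≤⟨ m≤m+n _ _ ⟩
    4 * ((4 + j) * 3) + (1 + 16 * j + 4 * (j * j))   ≡⟨ solve (j ∷ []) ⟩
    (7 + 2 * j) * (7 + 2 * j)                        ∎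
    where open ≤-Reasoning

sqrtGap[5,3]⇒k≡1 : ∀ k .{{_ : NonZero k}} → SqrtGapLt k 5 3 → k ≡ 1
sqrtGap[5,3]⇒k≡1 1 _ = refl
sqrtGap[5,3]⇒k≡1 (suc (suc i)) gap =
  contradiction (subst (λ K → Sqrt<Sqrt+1 (K * 5) (K * 3)) k²≡4+j gap) (¬Sqrt<Sqrt+1[5K,3K] (4 * i + i * i))
  where
  k²≡4+j : (2 + i) * (2 + i) ≡ 4 + (4 * i + i * i)
  k²≡4+j = solve (i ∷ [])

module HalfIntervalCount (k : ℕ) (N : ℚ)
  (sqrt-gap : ∀ q p → ConsecutivePrimes q p → N Q.≤ (+ p / 1) → SqrtGapLt k p q)
  (p : ℕ) (N<p/2 : N Q.< + p / 2) where

  UpperHalfPrime : ℕ → Set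
  UpperHalfPrime q = Prime q × p < 2 * q

  upperHalfPrime? : Decidable UpperHalfPrime
  upperHalfPrime? q = prime? q ×-dec (p <? 2 * q)

  count : ℕ → ℕ
  count = countBelow upperHalfPrime?

  Descends : ℕ → ℕ → Set
  Descends g x = ∀ u → u * u ≤ 25 * (k * k * g) →
    2 * ((u ∸ 5 * count x) * (u ∸ 5 * count x)) ≤ 25 * (k * k * p)

  descends-lowerHalf : ∀ {g} x → 2 * g ≤ p → Descends g x
  descends-lowerHalf {g} x 2g≤p u u²≤25k²g = begin
    2 * ((u ∸ 5 * count x) * (u ∸ 5 * count x)) ≤⟨ *-monoʳ-≤ 2 (square-mono-≤ (m∸n≤m u (5 * count x))) ⟩
    2 * (u * u)                                 ≤⟨ *-monoʳ-≤ 2 u²≤25k²g ⟩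
    2 * (25 * (k * k * g))                      ≡⟨ solve (k ∷ g ∷ []) ⟩
    25 * (k * k * (2 * g))                      ≤⟨ *-monoʳ-≤ 25 (*-monoʳ-≤ (k * k) 2g≤p) ⟩
    25 * (k * k * p)                            ∎
    where open ≤-Reasoning

  descends-step : ∀ {g x} → ConsecutivePrimes g x → p < 2 * x → Descends g x → Descends x (suc x)
  descends-step {g} {x} consecutive@(_ , px , _) p<2x descends u u²≤25k²x =
    subst (λ w → 2 * (w * w) ≤ 25 * (k * k * p)) u∸5∸5c≡u∸5c′
      (descends (u ∸ 5) (sqrt-descent 5 u (sqrt-gap g x consecutive (<half⇒≤ x N<p/2 p<2x)) u²≤25k²x))
    where
    open ≡-Reasoning
    u∸5∸5c≡u∸5c′ : u ∸ 5 ∸ 5 * count x ≡ u ∸ 5 * count (suc x)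
    u∸5∸5c≡u∸5c′ = begin
      u ∸ 5 ∸ 5 * count x     ≡⟨ ∸-+-assoc u 5 (5 * count x) ⟩
      u ∸ (5 + 5 * count x)   ≡⟨ cong (u ∸_) (sym (*-suc 5 (count x))) ⟩
      u ∸ 5 * suc (count x)   ≡⟨ cong (λ c → u ∸ 5 * c) (sym (countBelow-accept upperHalfPrime? (px , p<2x))) ⟩
      u ∸ 5 * count (suc x)   ∎

  descends-skip : ∀ {g x} → ¬ UpperHalfPrime x → Descends g x → Descends g (suc x)
  descends-skip {g} {x} ¬upper descends u u²≤25k²g =
    subst (λ c → 2 * ((u ∸ 5 * c) * (u ∸ 5 * c)) ≤ 25 * (k * k * p)) (sym (countBelow-reject upperHalfPrime? ¬upper))
      (descends u u²≤25k²g)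

  DescentBelow : ℕ → Set
  DescentBelow x = ∃[ g ] PrecedingPrime g x × Descends g x

  descentBelow-suc : ∀ {x} → DescentBelow x → DescentBelow (suc x)
  descentBelow-suc {x} (g , preceding@(pg , g<x , gap) , descends) with prime? x
  ... | no ¬px = g , precedingPrime-skip ¬px preceding , descends-skip (¬px ∘ proj₁) descends
  ... | yes px with p <? 2 * x
  ...   | yes p<2x = x , precedingPrime-self px , descends-step (pg , px , g<x , gap) p<2x descends
  ...   | no p≮2x  = x , precedingPrime-self px , descends-lowerHalf (suc x) (≮⇒≥ p≮2x)

  descentBelow : 4 ≤ p → ∀ n → DescentBelow (3 + n)
  descentBelow 4≤p zero    = 2 , precedingPrime[3] , descends-lowerHalf 3 4≤p
  descentBelow 4≤p (suc n) = descentBelow-suc (descentBelow 4≤p n)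

  descends[p] : Prime p → 4 ≤ p → Descends p (suc p)
  descends[p] pp 4≤p with subst DescentBelow (cong suc (m+[n∸m]≡n (≤-trans (m≤m+n 2 2) 4≤p))) (descentBelow 4≤p (p ∸ 2))
  ... | g , preceding , descends = subst (λ g → Descends g (suc p)) (precedingPrime-unique pp preceding) descends

  count-lower-bound : Prime p → 4 ≤ p → ∀ t → 16 * (t * t) ≤ k * k * p → t ≤ count p
  count-lower-bound pp 4≤p t 16t²≤k²p with floor-sqrt (25 * (k * k * p))
  ... | s , s²≤A , A<[1+s]² = ≮⇒≥ (λ c<t → <-irrefl refl (A<A c<t))
    where
    open ≤-Reasoning
    A = 25 * (k * k * p)
    count[1+p]≡1+c : count (suc p) ≡ suc (count p)
    count[1+p]≡1+c = countBelow-accept upperHalfPrime? {p} (pp , subst (p <_) (*-comm p 2) (m<m*n p 2 {{prime⇒nonZero pp}} ≤-refl))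
    20t≤s : 20 * t ≤ s
    20t≤s = ≤-pred (square-cancel-< (begin-strict
      20 * t * (20 * t)    ≡⟨ solve (t ∷ []) ⟩
      25 * (16 * (t * t))  ≤⟨ *-monoʳ-≤ 25 16t²≤k²p ⟩
      A                    <⟨ A<[1+s]² ⟩
      suc s * suc s        ∎))
    A<A : count p < t → A < A
    A<A c<t = begin-strict
      A                                                       <⟨ A<[1+s]² ⟩
      suc s * suc s                                           ≤⟨ [1+s]²≤2*w² {w = s ∸ 5 * t} 20≤s (3*s≤4*[s∸5t] t 20t≤s) ⟩
      2 * ((s ∸ 5 * t) * (s ∸ 5 * t))                         ≤⟨ *-monoʳ-≤ 2 (square-mono-≤ (∸-monoʳ-≤ s (*-monoʳ-≤ 5 c′≤t))) ⟩
      2 * ((s ∸ 5 * count (suc p)) * (s ∸ 5 * count (suc p))) ≤⟨ descends[p] pp 4≤p s s²≤A ⟩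
      A                                                       ∎
      where
      20≤s : 20 ≤ s
      20≤s = ≤-trans (*-monoʳ-≤ 20 (≤-trans (s≤s z≤n) c<t)) 20t≤s
      c′≤t : count (suc p) ≤ t
      c′≤t = subst (_≤ t) (sym count[1+p]≡1+c) c<t

lemma1 : (k : ℕ) → .{{_ : NonZero k}} → (N : ℚ) →
    (∀ q p → ConsecutivePrimes q p → N Q.≤ (+ p / 1) → SqrtGapLt k p q) →
    ∀ p → Prime p → N Q.< (+ p / 2) →
    AtLeastFloorKQuarterSqrt (primesInHalfInterval p) k p
lemma1 k N sqrt-gap p pp N<p/2 t 16t²≤k²p with p <? 4
... | no p≮4 = HalfIntervalCount.count-lower-bound k N sqrt-gap p N<p/2 pp (≮⇒≥ p≮4) t 16t²≤k²p
-- Below 4 there is no prime under p/2 to descend to; instead the gap hypothesis at (3, 5) forces k = 1.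
... | yes p<4 with sqrtGap[5,3]⇒k≡1 k (sqrt-gap 3 5 consecutivePrimes[3,5] (<half⇒≤ 5 N<p/2 (≤-trans p<4 (m≤m+n 4 6))))
...   | refl = subst (_≤ primesInHalfInterval p) (sym t≡0) z≤n
  where
  t≡0 : t ≡ 0
  t≡0 = n<1⇒n≡0 (square-cancel-< (*-cancelˡ-< 16 (t * t) 1 (begin-strict
    16 * (t * t) ≤⟨ 16t²≤k²p ⟩
    1 * 1 * p    ≡⟨ *-identityˡ p ⟩
    p            <⟨ p<4 ⟩
    4            ≤⟨ m≤m+n 4 12 ⟩
    16           ∎)))
    where open ≤-Reasoning
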